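{- For integers $i,j\ge0$, let $\beta^{(i,j)}$ be the strict partition whose parts are $1,2,\ldots,2j$ together with $2j+2k-1$ for $k=1,\ldots,i$. Let $\mathcal{P}_i$ be the set of partitions with at most $i$ parts, $\mathcal{E}_j$ the set of partitions into even parts with at most $j$ parts, and $\mathcal{D}_{i,j}=\{\lambda\in\mathcal{D}:\mathrm{sol}(\lambda)=i,\ \ell(\lambda)=i+2j\}$. Then there exists a bijection $$\varphi:\{\beta^{(i,j)}\}\times\mathcal{P}_i\times\mathcal{E}_j\to\mathcal{D}_{i,j},\quad(\beta^{(i,j)},\mu,\eta)\mapsto\lambda,$$ such that $|\lambda|=|\beta^{(i,j)}|+|\mu|+|\eta|$, $\ell(\lambda)=\ell(\beta^{(i,j)})$ and $\mathrm{sol}(\lambda)=\mathrm{sol}(\beta^{(i,j)})$.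
   Context: A partition is a weakly increasing list of positive integers (the empty partition allowed); $|\lambda|$ is the sum of its parts and $\ell(\lambda)$ the number of parts. $\mathcal{D}$ is the set of strict partitions (distinct parts). A sequence of a strict partition is a maximal string of consecutive integers all of which are parts; $\mathrm{sol}(\lambda)$ is the number of sequences of $\lambda$ of odd length. -}

module Defs where

open import Data.Nat using (ℕ; zero; suc; _+_; _*_; _<_; _≤_; _≟_)
open import Data.Nat.Divisibility using (_∣_)
open import Data.Nat.Base using (_%_)
open import Data.List using (List; []; _∷_; _++_; length; map; filter; upTo)
open import Data.Nat.ListAction using (sum)
open import Data.List.Relation.Unary.All using (All)
open import Data.List.Relation.Unary.Linked using (Linked)
open import Data.Product using (Σ; _×_)
open import Relation.Nullary using (yes; no)
open import Relation.Binary.PropositionalEquality using (_≡_)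

IsPartition : List ℕ → Set
IsPartition l = Linked _≤_ l × All (λ x → 0 < x) l

IsStrict : List ℕ → Set
IsStrict l = Linked _<_ l × All (λ x → 0 < x) l

∣_∣ₚ : List ℕ → ℕ
∣ l ∣ₚ = sum l

ℓ : List ℕ → ℕ
ℓ = length

runsFrom : ℕ → ℕ → List ℕ → List ℕ
runsFrom prev len [] = len ∷ []
runsFrom prev len (y ∷ ys) with y ≟ suc prev
... | yes _ = runsFrom y (suc len) ys
... | no _  = len ∷ runsFrom y 1 ys

runLengths : List ℕ → List ℕ
runLengths [] = []
runLengths (x ∷ xs) = runsFrom x 1 xs

-- sol(λ): number of sequences (maximal runs) of odd length.
sol : List ℕ → ℕ
sol l = length (filter (λ n → n % 2 ≟ 1) (runLengths l))

β : ℕ → ℕ → List ℕ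
β i j = map suc (upTo (2 * j)) ++ map (λ k → 2 * j + 2 * k + 1) (upTo i)

𝒫 : ℕ → Set
𝒫 i = Σ (List ℕ) λ μ → IsPartition μ × length μ ≤ i

ℰ : ℕ → Set
ℰ j = Σ (List ℕ) λ η → IsPartition η × All (λ x → 2 ∣ x) η × length η ≤ j

𝒟 : ℕ → ℕ → Set
𝒟 i j = Σ (List ℕ) λ l → IsStrict l × sol l ≡ i × length l ≡ i + 2 * j

{-# OPTIONS --safe #-}
module Submission where

-- Cut every maximal run of a strict partition λ greedily into pairs {x, x + 1}, followed by a
-- single when the run has odd length. Then sol λ is the number of singles and ℓ λ is
-- #singles + 2 #pairs. Listed from below, each block starts some gap g ≥ 0 above the least
-- position the previous block allows, and every word of gapped blocks arises. Let each
-- single's gap absorb the gaps of the pairs since the previous single, and each pair's gap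
-- those of the singles since the previous pair plus one for each of them. This turns λ into
-- two unconstrained gap lists of lengths i and j, whose prefix sums are a partition μ with at
-- most i parts and a partition with at most j parts whose double is η. As a gap adds to |λ|
-- its size times the number of parts from its block on, and a single placed before a pair
-- costs 2 more than the reverse order, |λ| = |β| + |μ| + |η|, where β is the word with all
-- gaps zero and the pairs first.

open import Defs
open import Data.Nat using (ℕ; zero; suc; _+_; _*_; _∸_; _<_; _≤_; _≟_; _≤?_; _%_; s≤s; z≤n; ⌊_/2⌋)
open import Data.Nat.Properties
open import Data.Nat.Divisibility using (_∣_; divides; m∣m*n)
open import Data.Nat.ListAction using (sum)
open import Data.Nat.Tactic.RingSolver using (solve-∀)
open import Data.List using (List; []; _∷_; _++_; length; map; filter; replicate; applyUpTo; upTo)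
open import Data.List.Properties
  using (filter-accept; filter-reject; length-++; length-replicate; length-map; map-upTo; map-∘; map-id-local)
open import Data.List.Relation.Unary.All as All using (All; []; _∷_)
import Data.List.Relation.Unary.All.Properties as All
open import Data.List.Relation.Unary.Linked as Linked using (Linked; []; [-]; _∷_)
import Data.List.Relation.Unary.Linked.Properties as Linked
open import Data.Product using (Σ; _×_; _,_; proj₁; proj₂)
open import Data.Product.Function.NonDependent.Propositional using (_×-↔_)
open import Data.Empty using (⊥-elim)
open import Level using (Level)
open import Function using (_∘_)
open import Function.Bundles using (_↔_; _⤖_; Inverse; Bijection; mk↔ₛ′)
open import Function.Construct.Composition using (_↔-∘_)
open import Function.Properties.Inverse using (↔⇒⤖)
open import Relation.Nullary using (yes; no; Irrelevant)
import Relation.Unary as U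
open import Relation.Binary.PropositionalEquality
open ≡-Reasoning

data Block : Set where
  single pair : ℕ → Block

Word : Set
Word = List Block

singles : Word → ℕ
singles []             = 0
singles (single _ ∷ w) = suc (singles w)
singles (pair _ ∷ w)   = singles w

pairs : Word → ℕ
pairs []             = 0
pairs (single _ ∷ w) = pairs w
pairs (pair _ ∷ w)   = suc (pairs w)

-- A block with gap g starts at g + p, and the next block may start two above that: so a pair
-- can be continued by the next block, but a single always ends its run.
layout : ℕ → Word → List ℕ
layout p []             = []
layout p (single g ∷ w) = g + p ∷ layout (2 + g + p) w
layout p (pair g ∷ w)   = g + p ∷ suc (g + p) ∷ layout (2 + g + p) w

canonical : ℕ → ℕ → Word
canonical i j = replicate j (pair 0) ++ replicate i (single 0)

length-layout : ∀ p w → length (layout p w) ≡ singles w + 2 * pairs w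
length-layout p []             = refl
length-layout p (single g ∷ w) = cong suc (length-layout _ w)
length-layout p (pair g ∷ w)   =
  trans (cong (2 +_) (length-layout _ w)) (shuffle (singles w) (pairs w))
  where
  shuffle : ∀ s q → 2 + (s + 2 * q) ≡ s + 2 * suc q
  shuffle = solve-∀

gap : Block → ℕ
gap (single g) = g
gap (pair g)   = g

mutual
  layout-linked : ∀ {x} p w → x < p → Linked _<_ (x ∷ layout p w)
  layout-linked p []      x<p = [-]
  layout-linked p (b ∷ w) x<p = layout-linked-∷ p b w (<-≤-trans x<p (m≤n+m p (gap b)))

  layout-linked-∷ : ∀ {x} p b w → x < gap b + p → Linked _<_ (x ∷ layout p (b ∷ w))
  layout-linked-∷ p (single g) w x<y = x<y ∷ layout-linked _ w (s≤s (n≤1+n _))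
  layout-linked-∷ p (pair g)   w x<y = x<y ∷ n<1+n _ ∷ layout-linked _ w (n<1+n _)

strict⇒linked₀ : ∀ {l} → IsStrict l → Linked _<_ (0 ∷ l)
strict⇒linked₀ (L , [])      = [-]
strict⇒linked₀ (L , 0<x ∷ _) = 0<x ∷ L

linked₀⇒strict : ∀ {l} → Linked _<_ (0 ∷ l) → IsStrict l
linked₀⇒strict [-]        = [] , []
linked₀⇒strict (0<x ∷ L) = L , Linked.Linked⇒All <-trans 0<x L

-- Runs of a layout

odd? : U.Decidable (λ n → n % 2 ≡ 1)
odd? n = n % 2 ≟ 1

oddCount : List ℕ → ℕ
oddCount l = length (filter odd? l)

n%2≢1⇒n%2≡0 : ∀ n → n % 2 ≢ 1 → n % 2 ≡ 0
n%2≢1⇒n%2≡0 zero          _   = refl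
n%2≢1⇒n%2≡0 (suc zero)    ≢1  = ⊥-elim (≢1 refl)
n%2≢1⇒n%2≡0 (suc (suc n)) ≢1  = n%2≢1⇒n%2≡0 n ≢1

n%2≡0⇒[1+n]%2≡1 : ∀ n → n % 2 ≡ 0 → suc n % 2 ≡ 1
n%2≡0⇒[1+n]%2≡1 zero          _  = refl
n%2≡0⇒[1+n]%2≡1 (suc (suc n)) ≡0 = n%2≡0⇒[1+n]%2≡1 n ≡0

oddCount-∷ : ∀ n l → oddCount (n ∷ l) ≡ n % 2 + oddCount l
oddCount-∷ n l with n % 2 ≟ 1
... | yes ≡1 = trans (cong length (filter-accept odd? {n} {l} ≡1)) (cong (_+ oddCount l) (sym ≡1))
... | no ≢1  = trans (cong length (filter-reject odd? {n} {l} ≢1))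
                     (cong (_+ oddCount l) (sym (n%2≢1⇒n%2≡0 n ≢1)))

runsFrom-adjacent : ∀ prev len ys → runsFrom prev len (suc prev ∷ ys) ≡ runsFrom (suc prev) (suc len) ys
runsFrom-adjacent prev len ys with suc prev ≟ suc prev
... | yes _ = refl
... | no ≢ = ⊥-elim (≢ refl)

oddCount-runsFrom-apart : ∀ prev len l → Linked _<_ (suc prev ∷ l) →
                          oddCount (runsFrom prev len l) ≡ len % 2 + sol l
oddCount-runsFrom-apart prev len []      _         = oddCount-∷ len []
oddCount-runsFrom-apart prev len (y ∷ l) (1+prev<y ∷ _) with y ≟ suc prev
... | yes refl = ⊥-elim (<-irrefl refl 1+prev<y)
... | no _     = oddCount-∷ len (runLengths (y ∷ l))

mutual
  sol-layout : ∀ p w → sol (layout p w) ≡ singles w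
  sol-layout p []             = refl
  sol-layout p (single g ∷ w) =
    trans (oddCount-runsFrom-apart (g + p) 1 _ (layout-linked _ w ≤-refl)) (cong suc (sol-layout _ w))
  sol-layout p (pair g ∷ w)   =
    trans (cong oddCount (runsFrom-adjacent (g + p) 1 _)) (oddCount-runsFrom-even (suc (g + p)) 2 w refl)

  oddCount-runsFrom-even : ∀ prev len w → len % 2 ≡ 0 →
                           oddCount (runsFrom prev len (layout (suc prev) w)) ≡ singles w
  oddCount-runsFrom-even prev len [] even = trans (oddCount-∷ len []) (cong (_+ 0) even)
  oddCount-runsFrom-even prev len (single zero ∷ w) even =
    trans (cong oddCount (runsFrom-adjacent prev len _))
      (trans (oddCount-runsFrom-apart (suc prev) (suc len) _ (layout-linked _ w ≤-refl))
        (cong₂ _+_ (n%2≡0⇒[1+n]%2≡1 len even) (sol-layout _ w)))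
  oddCount-runsFrom-even prev len (pair zero ∷ w) even =
    trans (cong oddCount (runsFrom-adjacent prev len _))
      (trans (cong oddCount (runsFrom-adjacent (suc prev) (suc len) _))
        (oddCount-runsFrom-even (2 + prev) (2 + len) w even))
  oddCount-runsFrom-even prev len (single (suc g) ∷ w) even =
    trans (oddCount-runsFrom-apart prev len _ (layout-linked-∷ _ (single (suc g)) w (s≤s (m≤n+m _ g))))
      (cong₂ _+_ even (sol-layout _ (single (suc g) ∷ w)))
  oddCount-runsFrom-even prev len (pair (suc g) ∷ w) even =
    trans (oddCount-runsFrom-apart prev len _ (layout-linked-∷ _ (pair (suc g)) w (s≤s (m≤n+m _ g))))
      (cong₂ _+_ even (sol-layout _ (pair (suc g) ∷ w)))

-- Segmenting a strict partition into blocks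

mutual
  segment : ℕ → List ℕ → Word
  segment p []      = []
  segment p (x ∷ l) = segment-∷ p x l

  segment-∷ : ℕ → ℕ → List ℕ → Word
  segment-∷ p x []      = single (x ∸ p) ∷ []
  segment-∷ p x (y ∷ l) with y ≟ suc x
  ... | yes _ = pair (x ∸ p) ∷ segment (2 + x) l
  ... | no _  = single (x ∸ p) ∷ segment-∷ (2 + x) y l

segment-adjacent : ∀ p x l → segment p (x ∷ suc x ∷ l) ≡ pair (x ∸ p) ∷ segment (2 + x) l
segment-adjacent p x l with suc x ≟ suc x
... | yes _ = refl
... | no ≢ = ⊥-elim (≢ refl)

segment-apart : ∀ p x l → Linked _<_ (suc x ∷ l) →
                segment p (x ∷ l) ≡ single (x ∸ p) ∷ segment (2 + x) l
segment-apart p x []      _             = refl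
segment-apart p x (y ∷ l) (1+x<y ∷ _) with y ≟ suc x
... | yes refl = ⊥-elim (<-irrefl refl 1+x<y)
... | no _     = refl

segment-layout : ∀ p w → segment p (layout p w) ≡ w
segment-layout p []             = refl
segment-layout p (single g ∷ w) =
  trans (segment-apart p (g + p) _ (layout-linked _ w ≤-refl))
        (cong₂ (λ g′ w′ → single g′ ∷ w′) (m+n∸n≡m g p) (segment-layout _ w))
segment-layout p (pair g ∷ w)   =
  trans (segment-adjacent p (g + p) _)
        (cong₂ (λ g′ w′ → pair g′ ∷ w′) (m+n∸n≡m g p) (segment-layout _ w))

mutual
  layout-segment : ∀ q l → Linked _<_ (q ∷ l) → layout (suc q) (segment (suc q) l) ≡ l
  layout-segment q []      _           = refl
  layout-segment q (x ∷ l) (q<x ∷ L) = layout-segment-∷ q x l q<x L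

  layout-segment-∷ : ∀ q x l → q < x → Linked _<_ (x ∷ l) →
                     layout (suc q) (segment-∷ (suc q) x l) ≡ x ∷ l
  layout-segment-∷ q x []      q<x _ = cong (_∷ []) (m∸n+n≡m q<x)
  layout-segment-∷ q x (y ∷ l) q<x (x<y ∷ L) with y ≟ suc x
  ... | yes refl rewrite m∸n+n≡m q<x = cong (λ l′ → x ∷ suc x ∷ l′) (layout-segment (suc x) l L)
  ... | no y≢1+x rewrite m∸n+n≡m q<x =
    cong (x ∷_) (layout-segment-∷ (suc x) y l (≤∧≢⇒< x<y (≢-sym y≢1+x)) L)

-- Separating the gaps of singles and pairs

addHead : ℕ → List ℕ → List ℕ
addHead c []       = []
addHead c (x ∷ xs) = c + x ∷ xs

split : Word → List ℕ × List ℕ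
split []             = [] , []
split (single g ∷ w) = g ∷ proj₁ (split w) , addHead (suc g) (proj₂ (split w))
split (pair g ∷ w)   = addHead g (proj₁ (split w)) , g ∷ proj₂ (split w)

-- The inverse of split: the next pair comes before the next single exactly when its gap is at
-- most the single's.
mutual
  merge : List ℕ → List ℕ → Word
  merge []      v = map pair v
  merge (a ∷ u) v = merge-∷ a u v

  merge-∷ : ℕ → List ℕ → List ℕ → Word
  merge-∷ a u []      = single a ∷ map single u
  merge-∷ a u (b ∷ v) with b ≤? a
  ... | yes _ = pair b ∷ merge-∷ (a ∸ b) u v
  ... | no _  = single a ∷ merge u (b ∸ suc a ∷ v)

split-map-pair : ∀ v → split (map pair v) ≡ ([] , v)
split-map-pair []      = refl
split-map-pair (b ∷ v) rewrite split-map-pair v = refl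

split-map-single : ∀ u → split (map single u) ≡ (u , [])
split-map-single []      = refl
split-map-single (a ∷ u) rewrite split-map-single u = refl

mutual
  split-merge : ∀ u v → split (merge u v) ≡ (u , v)
  split-merge []      v = split-map-pair v
  split-merge (a ∷ u) v = split-merge-∷ a u v

  split-merge-∷ : ∀ a u v → split (merge-∷ a u v) ≡ (a ∷ u , v)
  split-merge-∷ a u [] rewrite split-map-single u = refl
  split-merge-∷ a u (b ∷ v) with b ≤? a
  ... | yes b≤a rewrite split-merge-∷ (a ∸ b) u v | m+[n∸m]≡n b≤a = refl
  ... | no b≰a  rewrite split-merge u (b ∸ suc a ∷ v) | m+[n∸m]≡n (≰⇒> b≰a) = refl

merge-[] : ∀ u → merge u [] ≡ map single u
merge-[] []      = refl
merge-[] (a ∷ u) = refl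

merge-single : ∀ a u v → merge (a ∷ u) (addHead (suc a) v) ≡ single a ∷ merge u v
merge-single a u []      = cong (single a ∷_) (sym (merge-[] u))
merge-single a u (b ∷ v) with suc a + b ≤? a
... | yes 1+a+b≤a = ⊥-elim (<-irrefl refl (≤-trans (s≤s (m≤m+n (suc a) b)) (s≤s 1+a+b≤a)))
... | no _ rewrite m+n∸m≡n (suc a) b = refl

merge-pair : ∀ b u v → merge (addHead b u) (b ∷ v) ≡ pair b ∷ merge u v
merge-pair b []      v = refl
merge-pair b (a ∷ u) v with b ≤? b + a
... | yes _   rewrite m+n∸m≡n b a = refl
... | no b≰b+a = ⊥-elim (b≰b+a (m≤m+n b a))

merge-split : ∀ w → merge (proj₁ (split w)) (proj₂ (split w)) ≡ w
merge-split []             = refl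
merge-split (single g ∷ w) =
  trans (merge-single g (proj₁ (split w)) (proj₂ (split w))) (cong (single g ∷_) (merge-split w))
merge-split (pair g ∷ w)   =
  trans (merge-pair g (proj₁ (split w)) (proj₂ (split w))) (cong (pair g ∷_) (merge-split w))

length-addHead : ∀ c v → length (addHead c v) ≡ length v
length-addHead c []      = refl
length-addHead c (_ ∷ v) = refl

length-split₁ : ∀ w → length (proj₁ (split w)) ≡ singles w
length-split₁ []             = refl
length-split₁ (single g ∷ w) = cong suc (length-split₁ w)
length-split₁ (pair g ∷ w)   = trans (length-addHead g (proj₁ (split w))) (length-split₁ w)

length-split₂ : ∀ w → length (proj₂ (split w)) ≡ pairs w
length-split₂ []             = refl
length-split₂ (single g ∷ w) = trans (length-addHead (suc g) (proj₂ (split w))) (length-split₂ w)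
length-split₂ (pair g ∷ w)   = cong suc (length-split₂ w)

singles-merge : ∀ u v → singles (merge u v) ≡ length u
singles-merge u v = trans (sym (length-split₁ (merge u v))) (cong (length ∘ proj₁) (split-merge u v))

pairs-merge : ∀ u v → pairs (merge u v) ≡ length v
pairs-merge u v = trans (sym (length-split₂ (merge u v))) (cong (length ∘ proj₂) (split-merge u v))

-- The size of a layout

sumPrefixSums : List ℕ → ℕ
sumPrefixSums []       = 0
sumPrefixSums (g ∷ gs) = g * length (g ∷ gs) + sumPrefixSums gs

sumPrefixSums-addHead : ∀ c v → sumPrefixSums (addHead c v) ≡ c * length v + sumPrefixSums v
sumPrefixSums-addHead c []      = sym (cong (_+ 0) (*-zeroʳ c))
sumPrefixSums-addHead c (g ∷ v) =
  trans (cong (_+ sumPrefixSums v) (*-distribʳ-+ (length (g ∷ v)) c g))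
        (+-assoc (c * length (g ∷ v)) (g * length (g ∷ v)) (sumPrefixSums v))

triangle : ℕ → ℕ
triangle zero    = 0
triangle (suc n) = n + triangle n

-- The sum of layout 0 (canonical i j).
baseSum : ℕ → ℕ → ℕ
baseSum i j = 2 * triangle i + 4 * triangle j + j + 2 * i * j

sum-layout : ∀ p w → let (u , v) = split w in
  sum (layout p w) ≡ p * (singles w + 2 * pairs w) + baseSum (singles w) (pairs w)
                     + sumPrefixSums u + 2 * sumPrefixSums v
sum-layout p [] = sym (arith p)
  where
  arith : ∀ p → p * (0 + 2 * 0) + (2 * 0 + 4 * 0 + 0 + 2 * 0 * 0) + 0 + 2 * 0 ≡ 0
  arith = solve-∀
sum-layout p (single g ∷ w) = begin
  g + p + sum (layout (2 + g + p) w)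
    ≡⟨ cong (g + p +_) (sum-layout (2 + g + p) w) ⟩
  g + p + ((2 + g + p) * (s + 2 * q) + baseSum s q + U + 2 * V)
    ≡⟨ arith g p s q (triangle s) (triangle q) U V ⟩
  p * (suc s + 2 * q) + baseSum (suc s) q + (g * suc s + U) + 2 * (suc g * q + V)
    ≡⟨ cong₂ (λ m n → p * (suc s + 2 * q) + baseSum (suc s) q + (g * suc m + U) + 2 * n)
             (sym (length-split₁ w))
             (sym (trans (sumPrefixSums-addHead (suc g) v) (cong (λ n → suc g * n + V) (length-split₂ w)))) ⟩
  p * (suc s + 2 * q) + baseSum (suc s) q + sumPrefixSums (g ∷ u) + 2 * sumPrefixSums (addHead (suc g) v) ∎
  where
  s = singles w
  q = pairs w
  u = proj₁ (split w)
  v = proj₂ (split w)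
  U = sumPrefixSums u
  V = sumPrefixSums v
  arith : ∀ g p s q ts tq U V →
    g + p + ((2 + g + p) * (s + 2 * q) + (2 * ts + 4 * tq + q + 2 * s * q) + U + 2 * V)
    ≡ p * (suc s + 2 * q) + (2 * (s + ts) + 4 * tq + q + 2 * suc s * q) + (g * suc s + U) + 2 * (suc g * q + V)
  arith = solve-∀
sum-layout p (pair g ∷ w) = begin
  g + p + (suc (g + p) + sum (layout (2 + g + p) w))
    ≡⟨ cong (λ n → g + p + (suc (g + p) + n)) (sum-layout (2 + g + p) w) ⟩
  g + p + (suc (g + p) + ((2 + g + p) * (s + 2 * q) + baseSum s q + U + 2 * V))
    ≡⟨ arith g p s q (triangle s) (triangle q) U V ⟩
  p * (s + 2 * suc q) + baseSum s (suc q) + (g * s + U) + 2 * (g * suc q + V)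
    ≡⟨ cong₂ (λ m n → p * (s + 2 * suc q) + baseSum s (suc q) + m + 2 * (g * suc n + V))
             (sym (trans (sumPrefixSums-addHead g u) (cong (λ n → g * n + U) (length-split₁ w))))
             (sym (length-split₂ w)) ⟩
  p * (s + 2 * suc q) + baseSum s (suc q) + sumPrefixSums (addHead g u) + 2 * sumPrefixSums (g ∷ v) ∎
  where
  s = singles w
  q = pairs w
  u = proj₁ (split w)
  v = proj₂ (split w)
  U = sumPrefixSums u
  V = sumPrefixSums v
  arith : ∀ g p s q ts tq U V →
    g + p + (suc (g + p) + ((2 + g + p) * (s + 2 * q) + (2 * ts + 4 * tq + q + 2 * s * q) + U + 2 * V))
    ≡ p * (s + 2 * suc q) + (2 * ts + 4 * (q + tq) + suc q + 2 * s * suc q) + (g * s + U) + 2 * (g * suc q + V)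
  arith = solve-∀

-- β as a layout

addHead-0 : ∀ u → addHead 0 u ≡ u
addHead-0 []      = refl
addHead-0 (_ ∷ u) = refl

split-canonical : ∀ i j → split (canonical i j) ≡ (replicate i 0 , replicate j 0)
split-canonical zero    zero    = refl
split-canonical (suc i) zero    rewrite split-canonical i zero = refl
split-canonical i       (suc j) rewrite split-canonical i j | addHead-0 (replicate i 0) = refl

sumPrefixSums-replicate-0 : ∀ n → sumPrefixSums (replicate n 0) ≡ 0
sumPrefixSums-replicate-0 zero    = refl
sumPrefixSums-replicate-0 (suc n) = sumPrefixSums-replicate-0 n

layout-pairs : ∀ j r (f : ℕ → ℕ) → (∀ k → f (suc k) ≡ suc (f k)) →
               layout (f 0) (replicate j (pair 0) ++ r) ≡ applyUpTo f (2 * j) ++ layout (f (2 * j)) r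
layout-pairs zero    r f f-suc = refl
-- 2 * suc j normalises to suc (j + suc (j + 0)).
layout-pairs (suc j) r f f-suc rewrite +-suc j (j + 0) | sym (f-suc 0) | sym (f-suc 1) =
  cong (λ l → f 0 ∷ f 1 ∷ l) (layout-pairs j r (f ∘ suc ∘ suc) (f-suc ∘ suc ∘ suc))

layout-singles : ∀ i (f : ℕ → ℕ) → (∀ k → f (suc k) ≡ 2 + f k) →
                 layout (f 0) (replicate i (single 0)) ≡ applyUpTo f i
layout-singles zero    f f-suc = refl
layout-singles (suc i) f f-suc rewrite sym (f-suc 0) =
  cong (f 0 ∷_) (layout-singles i (f ∘ suc) (f-suc ∘ suc))

β≡layout-canonical : ∀ i j → β i j ≡ layout 1 (canonical i j)
β≡layout-canonical i j = begin
  map suc (upTo (2 * j)) ++ map f (upTo i)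
    ≡⟨ cong₂ _++_ (map-upTo suc (2 * j)) (map-upTo f i) ⟩
  applyUpTo suc (2 * j) ++ applyUpTo f i
    ≡⟨ cong (applyUpTo suc (2 * j) ++_) (sym (layout-singles i f f-suc)) ⟩
  applyUpTo suc (2 * j) ++ layout (f 0) (replicate i (single 0))
    ≡⟨ cong (λ p → applyUpTo suc (2 * j) ++ layout p (replicate i (single 0))) f0 ⟩
  applyUpTo suc (2 * j) ++ layout (suc (2 * j)) (replicate i (single 0))
    ≡⟨ sym (layout-pairs j (replicate i (single 0)) suc (λ _ → refl)) ⟩
  layout 1 (canonical i j) ∎
  where
  f : ℕ → ℕ
  f k = 2 * j + 2 * k + 1
  shift : ∀ n k → 2 * n + 2 * suc k + 1 ≡ 2 + (2 * n + 2 * k + 1)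
  shift = solve-∀
  start : ∀ n → 2 * n + 2 * 0 + 1 ≡ suc (2 * n)
  start = solve-∀
  f-suc : ∀ k → f (suc k) ≡ 2 + f k
  f-suc = shift j
  f0 : f 0 ≡ suc (2 * j)
  f0 = start j

singles-canonical : ∀ i j → singles (canonical i j) ≡ i
singles-canonical i j = begin
  singles (canonical i j)                  ≡⟨ length-split₁ (canonical i j) ⟨
  length (proj₁ (split (canonical i j)))   ≡⟨ cong (length ∘ proj₁) (split-canonical i j) ⟩
  length (replicate i 0)                   ≡⟨ length-replicate i ⟩
  i                                        ∎

pairs-canonical : ∀ i j → pairs (canonical i j) ≡ j
pairs-canonical i j = begin
  pairs (canonical i j)                    ≡⟨ length-split₂ (canonical i j) ⟨
  length (proj₂ (split (canonical i j)))   ≡⟨ cong (length ∘ proj₂) (split-canonical i j) ⟩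
  length (replicate j 0)                   ≡⟨ length-replicate j ⟩
  j                                        ∎

length-β : ∀ i j → ℓ (β i j) ≡ i + 2 * j
length-β i j = begin
  length (β i j)
    ≡⟨ cong length (β≡layout-canonical i j) ⟩
  length (layout 1 (canonical i j))
    ≡⟨ length-layout 1 (canonical i j) ⟩
  singles (canonical i j) + 2 * pairs (canonical i j)
    ≡⟨ cong₂ (λ s q → s + 2 * q) (singles-canonical i j) (pairs-canonical i j) ⟩
  i + 2 * j ∎

sol-β : ∀ i j → sol (β i j) ≡ i
sol-β i j = begin
  sol (β i j)                     ≡⟨ cong sol (β≡layout-canonical i j) ⟩
  sol (layout 1 (canonical i j))  ≡⟨ sol-layout 1 (canonical i j) ⟩
  singles (canonical i j)         ≡⟨ singles-canonical i j ⟩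
  i                               ∎

sum-layout-counts : ∀ {i j} w → singles w ≡ i → pairs w ≡ j → let (u , v) = split w in
  sum (layout 1 w) ≡ 1 * (i + 2 * j) + baseSum i j + sumPrefixSums u + 2 * sumPrefixSums v
sum-layout-counts w refl refl = sum-layout 1 w

sum-β : ∀ i j → sum (β i j) ≡ 1 * (i + 2 * j) + baseSum i j
sum-β i j = begin
  sum (β i j)
    ≡⟨ cong sum (β≡layout-canonical i j) ⟩
  sum (layout 1 (canonical i j))
    ≡⟨ sum-layout-counts (canonical i j) (singles-canonical i j) (pairs-canonical i j) ⟩
  1 * (i + 2 * j) + baseSum i j + sumPrefixSums u + 2 * sumPrefixSums v
    ≡⟨ cong (λ (u′ , v′) → 1 * (i + 2 * j) + baseSum i j + sumPrefixSums u′ + 2 * sumPrefixSums v′)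
            (split-canonical i j) ⟩
  1 * (i + 2 * j) + baseSum i j + sumPrefixSums (replicate i 0) + 2 * sumPrefixSums (replicate j 0)
    ≡⟨ cong₂ (λ m n → 1 * (i + 2 * j) + baseSum i j + m + 2 * n)
             (sumPrefixSums-replicate-0 i) (sumPrefixSums-replicate-0 j) ⟩
  1 * (i + 2 * j) + baseSum i j + 0 + 0
    ≡⟨ trans (+-identityʳ _) (+-identityʳ _) ⟩
  1 * (i + 2 * j) + baseSum i j ∎
  where
  u = proj₁ (split (canonical i j))
  v = proj₂ (split (canonical i j))

sum-layout-merge : ∀ {i j} u v → length u ≡ i → length v ≡ j →
  sum (layout 1 (merge u v)) ≡ sum (β i j) + sumPrefixSums u + 2 * sumPrefixSums v
sum-layout-merge {i} {j} u v ℓu≡i ℓv≡j = begin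
  sum (layout 1 w)
    ≡⟨ sum-layout-counts w (trans (singles-merge u v) ℓu≡i) (trans (pairs-merge u v) ℓv≡j) ⟩
  1 * (i + 2 * j) + baseSum i j + sumPrefixSums (proj₁ (split w)) + 2 * sumPrefixSums (proj₂ (split w))
    ≡⟨ cong (λ (u′ , v′) → 1 * (i + 2 * j) + baseSum i j + sumPrefixSums u′ + 2 * sumPrefixSums v′)
            (split-merge u v) ⟩
  1 * (i + 2 * j) + baseSum i j + sumPrefixSums u + 2 * sumPrefixSums v
    ≡⟨ cong (λ m → m + sumPrefixSums u + 2 * sumPrefixSums v) (sum-β i j) ⟨
  sum (β i j) + sumPrefixSums u + 2 * sumPrefixSums v ∎
  where
  w = merge u v

-- Partitions as gap lists

prefixSums : ℕ → List ℕ → List ℕ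
prefixSums s []       = []
prefixSums s (g ∷ gs) = s + g ∷ prefixSums (s + g) gs

differences : ℕ → List ℕ → List ℕ
differences p []       = []
differences p (x ∷ xs) = x ∸ p ∷ differences x xs

fromGaps : List ℕ → List ℕ
fromGaps []           = []
fromGaps (zero ∷ gs)  = fromGaps gs
fromGaps (suc g ∷ gs) = suc g ∷ prefixSums (suc g) gs

-- A partition with at most n parts, padded with zeros to exactly n parts, is determined by
-- its n successive differences; fromGaps drops the zero parts again.
toGaps : ℕ → List ℕ → List ℕ
toGaps n μ = replicate (n ∸ length μ) 0 ++ differences 0 μ

length-prefixSums : ∀ s gs → length (prefixSums s gs) ≡ length gs
length-prefixSums s []       = refl
length-prefixSums s (g ∷ gs) = cong suc (length-prefixSums (s + g) gs)

length-differences : ∀ p xs → length (differences p xs) ≡ length xs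
length-differences p []       = refl
length-differences p (x ∷ xs) = cong suc (length-differences x xs)

prefixSums-linked : ∀ s gs → Linked _≤_ (s ∷ prefixSums s gs)
prefixSums-linked s []       = [-]
prefixSums-linked s (g ∷ gs) = m≤m+n s g ∷ prefixSums-linked (s + g) gs

fromGaps-isPartition : ∀ gs → IsPartition (fromGaps gs)
fromGaps-isPartition []           = [] , []
fromGaps-isPartition (zero ∷ gs)  = fromGaps-isPartition gs
fromGaps-isPartition (suc g ∷ gs) = L , Linked.Linked⇒All ≤-trans (s≤s z≤n) L
  where L = prefixSums-linked (suc g) gs

length-fromGaps : ∀ gs → length (fromGaps gs) ≤ length gs
length-fromGaps []           = z≤n
length-fromGaps (zero ∷ gs)  = m≤n⇒m≤1+n (length-fromGaps gs)
length-fromGaps (suc g ∷ gs) = s≤s (≤-reflexive (length-prefixSums (suc g) gs))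

length-toGaps : ∀ n μ → length μ ≤ n → length (toGaps n μ) ≡ n
length-toGaps n μ ℓμ≤n = begin
  length (replicate (n ∸ length μ) 0 ++ differences 0 μ)
    ≡⟨ length-++ (replicate (n ∸ length μ) 0) ⟩
  length (replicate (n ∸ length μ) 0) + length (differences 0 μ)
    ≡⟨ cong₂ _+_ (length-replicate (n ∸ length μ)) (length-differences 0 μ) ⟩
  n ∸ length μ + length μ
    ≡⟨ m∸n+n≡m ℓμ≤n ⟩
  n ∎

sum-prefixSums : ∀ s gs → sum (prefixSums s gs) ≡ s * length gs + sumPrefixSums gs
sum-prefixSums s []       = sym (cong (_+ 0) (*-zeroʳ s))
sum-prefixSums s (g ∷ gs) = begin
  s + g + sum (prefixSums (s + g) gs)
    ≡⟨ cong (s + g +_) (sum-prefixSums (s + g) gs) ⟩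
  s + g + ((s + g) * length gs + sumPrefixSums gs)
    ≡⟨ arith s g (length gs) (sumPrefixSums gs) ⟩
  s * suc (length gs) + (g * suc (length gs) + sumPrefixSums gs) ∎
  where
  arith : ∀ s g n S → s + g + ((s + g) * n + S) ≡ s * suc n + (g * suc n + S)
  arith = solve-∀

sum-fromGaps : ∀ gs → sum (fromGaps gs) ≡ sumPrefixSums gs
sum-fromGaps []           = refl
sum-fromGaps (zero ∷ gs)  = sum-fromGaps gs
sum-fromGaps (suc g ∷ gs) = begin
  suc g + sum (prefixSums (suc g) gs)
    ≡⟨ cong (suc g +_) (sum-prefixSums (suc g) gs) ⟩
  suc g + (suc g * length gs + sumPrefixSums gs)
    ≡⟨ sym (+-assoc (suc g) _ _) ⟩
  suc g + suc g * length gs + sumPrefixSums gs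
    ≡⟨ cong (_+ sumPrefixSums gs) (sym (*-suc (suc g) (length gs))) ⟩
  suc g * suc (length gs) + sumPrefixSums gs ∎

fromGaps-replicate-0 : ∀ k gs → fromGaps (replicate k 0 ++ gs) ≡ fromGaps gs
fromGaps-replicate-0 zero    gs = refl
fromGaps-replicate-0 (suc k) gs = fromGaps-replicate-0 k gs

prefixSums-differences : ∀ p xs → Linked _≤_ (p ∷ xs) → prefixSums p (differences p xs) ≡ xs
prefixSums-differences p []       _          = refl
prefixSums-differences p (x ∷ xs) (p≤x ∷ L) rewrite m+[n∸m]≡n p≤x =
  cong (x ∷_) (prefixSums-differences x xs L)

differences-prefixSums : ∀ s gs → differences s (prefixSums s gs) ≡ gs
differences-prefixSums s []       = refl
differences-prefixSums s (g ∷ gs) = cong₂ _∷_ (m+n∸m≡n s g) (differences-prefixSums (s + g) gs)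

fromGaps-toGaps : ∀ n μ → IsPartition μ → fromGaps (toGaps n μ) ≡ μ
fromGaps-toGaps n []      _              = fromGaps-replicate-0 n []
fromGaps-toGaps n (suc x ∷ xs) (L , _ ∷ _) =
  trans (fromGaps-replicate-0 (n ∸ length (suc x ∷ xs)) _)
        (cong (suc x ∷_) (prefixSums-differences (suc x) xs L))

toGaps-fromGaps : ∀ gs → toGaps (length gs) (fromGaps gs) ≡ gs
toGaps-fromGaps []           = refl
toGaps-fromGaps (zero ∷ gs) rewrite +-∸-assoc 1 (length-fromGaps gs) = cong (0 ∷_) (toGaps-fromGaps gs)
toGaps-fromGaps (suc g ∷ gs) rewrite length-prefixSums (suc g) gs | n∸n≡0 (length gs) =
  cong (suc g ∷_) (differences-prefixSums (suc g) gs)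

private variable ℓa ℓb ℓp ℓq : Level

×-irrelevant : ∀ {A : Set ℓa} {B : Set ℓb} → Irrelevant A → Irrelevant B → Irrelevant (A × B)
×-irrelevant A-irr B-irr (a , b) (a′ , b′) = cong₂ _,_ (A-irr a a′) (B-irr b b′)

∣-irrelevant : ∀ {m n} → Irrelevant (suc m ∣ n)
∣-irrelevant {m} (divides q eq) (divides q′ eq′) with *-cancelʳ-≡ q q′ (suc m) (trans (sym eq) eq′)
... | refl = cong (divides q) (≡-irrelevant eq eq′)

isPartition-irrelevant : U.Irrelevant IsPartition
isPartition-irrelevant = ×-irrelevant (Linked.irrelevant ≤-irrelevant) (All.irrelevant ≤-irrelevant)

isStrict-irrelevant : U.Irrelevant IsStrict
isStrict-irrelevant = ×-irrelevant (Linked.irrelevant <-irrelevant) (All.irrelevant ≤-irrelevant)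

Σ-≡-irrelevant : ∀ {A : Set ℓa} {P : A → Set ℓp} → U.Irrelevant P →
                 ∀ {a b} {p : P a} {q : P b} → a ≡ b → (a , p) ≡ (b , q)
Σ-≡-irrelevant P-irr refl = cong (_ ,_) (P-irr _ _)

restrict-↔ : ∀ {A : Set ℓa} {B : Set ℓb} {P : A → Set ℓp} {Q : B → Set ℓq} →
             U.Irrelevant P → U.Irrelevant Q →
             (f : A → B) (g : B → A) → (∀ {a} → P a → Q (f a)) → (∀ {b} → Q b → P (g b)) →
             (∀ {b} → Q b → f (g b) ≡ b) → (∀ {a} → P a → g (f a) ≡ a) → Σ A P ↔ Σ B Q
restrict-↔ P-irr Q-irr f g f-pres g-pres f∘g g∘f = mk↔ₛ′
  (λ (a , p) → f a , f-pres p)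
  (λ (b , q) → g b , g-pres q)
  (λ (b , q) → Σ-≡-irrelevant Q-irr (f∘g q))
  (λ (a , p) → Σ-≡-irrelevant P-irr (g∘f p))

Gaps : ℕ → Set
Gaps n = Σ (List ℕ) λ u → length u ≡ n

Words : ℕ → ℕ → Set
Words i j = Σ Word λ w → singles w ≡ i × pairs w ≡ j

𝒫↔Gaps : ∀ n → 𝒫 n ↔ Gaps n
𝒫↔Gaps n = restrict-↔ (×-irrelevant isPartition-irrelevant ≤-irrelevant) ≡-irrelevant
  (toGaps n) fromGaps
  (λ {μ} (_ , ℓμ≤n) → length-toGaps n μ ℓμ≤n)
  (λ {u} ℓu≡n → fromGaps-isPartition u , subst (length (fromGaps u) ≤_) ℓu≡n (length-fromGaps u))
  (λ {u} ℓu≡n → subst (λ n → toGaps n (fromGaps u) ≡ u) ℓu≡n (toGaps-fromGaps u))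
  (λ {μ} (μ-part , _) → fromGaps-toGaps n μ μ-part)

sumPrefixSums-𝒫↔Gaps : ∀ {n} (μ : 𝒫 n) →
                       sumPrefixSums (proj₁ (Inverse.to (𝒫↔Gaps n) μ)) ≡ sum (proj₁ μ)
sumPrefixSums-𝒫↔Gaps {n} (μ , μ-part , _) =
  trans (sym (sum-fromGaps (toGaps n μ))) (cong sum (fromGaps-toGaps n μ μ-part))

⌊2*n/2⌋≡n : ∀ n → ⌊ 2 * n /2⌋ ≡ n
⌊2*n/2⌋≡n n = sym (trans (n≡⌊n+n/2⌋ n) (cong (λ m → ⌊ n + m /2⌋) (sym (+-identityʳ n))))

2*⌊n/2⌋≡n : ∀ {n} → 2 ∣ n → 2 * ⌊ n /2⌋ ≡ n
2*⌊n/2⌋≡n (divides q refl) rewrite *-comm q 2 = cong (2 *_) (⌊2*n/2⌋≡n q)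

⌊n/2⌋>0 : ∀ {n} → 2 ∣ n → 0 < n → 0 < ⌊ n /2⌋
⌊n/2⌋>0 (divides (suc q) refl) _ = s≤s z≤n

ℰ↔𝒫 : ∀ n → ℰ n ↔ 𝒫 n
ℰ↔𝒫 n = restrict-↔
  (×-irrelevant isPartition-irrelevant (×-irrelevant (All.irrelevant ∣-irrelevant) ≤-irrelevant))
  (×-irrelevant isPartition-irrelevant ≤-irrelevant)
  (map ⌊_/2⌋) (map (2 *_))
  (λ {η} ((η↗ , η>0) , η-even , ℓη≤n) →
    ( Linked.map⁺ (Linked.map ⌊n/2⌋-mono η↗)
    , All.map⁺ (All.zipWith (λ (even , pos) → ⌊n/2⌋>0 even pos) (η-even , η>0)))
    , subst (_≤ n) (sym (length-map ⌊_/2⌋ η)) ℓη≤n)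
  (λ {μ} ((μ↗ , μ>0) , ℓμ≤n) →
    ( Linked.map⁺ (Linked.map (*-monoʳ-≤ 2) μ↗)
    , All.map⁺ (All.map (λ {x} x>0 → ≤-trans x>0 (m≤m+n x _)) μ>0))
    , All.map⁺ (All.universal m∣m*n μ)
    , subst (_≤ n) (sym (length-map (2 *_) μ)) ℓμ≤n)
  (λ {μ} _ → trans (sym (map-∘ μ)) (map-id-local (All.universal ⌊2*n/2⌋≡n μ)))
  (λ {η} (_ , η-even , _) → trans (sym (map-∘ η)) (map-id-local (All.map 2*⌊n/2⌋≡n η-even)))

2*sum-map-⌊/2⌋ : ∀ {η} → All (2 ∣_) η → 2 * sum (map ⌊_/2⌋ η) ≡ sum η
2*sum-map-⌊/2⌋ {[]}    []               = refl
2*sum-map-⌊/2⌋ {x ∷ η} (x-even ∷ η-even) = begin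
  2 * (⌊ x /2⌋ + sum (map ⌊_/2⌋ η))    ≡⟨ *-distribˡ-+ 2 ⌊ x /2⌋ _ ⟩
  2 * ⌊ x /2⌋ + 2 * sum (map ⌊_/2⌋ η)  ≡⟨ cong₂ _+_ (2*⌊n/2⌋≡n x-even) (2*sum-map-⌊/2⌋ η-even) ⟩
  x + sum η                            ∎

2*sum-ℰ↔𝒫 : ∀ {n} (η : ℰ n) → 2 * sum (proj₁ (Inverse.to (ℰ↔𝒫 n) η)) ≡ sum (proj₁ η)
2*sum-ℰ↔𝒫 (_ , _ , η-even , _) = 2*sum-map-⌊/2⌋ η-even

Gaps×Gaps↔Words : ∀ i j → (Gaps i × Gaps j) ↔ Words i j
Gaps×Gaps↔Words i j = mk↔ₛ′
  (λ ((u , ℓu≡i) , (v , ℓv≡j)) →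
    merge u v , trans (singles-merge u v) ℓu≡i , trans (pairs-merge u v) ℓv≡j)
  (λ (w , s≡i , q≡j) →
    (proj₁ (split w) , trans (length-split₁ w) s≡i) , (proj₂ (split w) , trans (length-split₂ w) q≡j))
  (λ (w , _) → Σ-≡-irrelevant (×-irrelevant ≡-irrelevant ≡-irrelevant) (merge-split w))
  (λ ((u , _) , (v , _)) → cong₂ _,_ (Σ-≡-irrelevant ≡-irrelevant (cong proj₁ (split-merge u v)))
                                     (Σ-≡-irrelevant ≡-irrelevant (cong proj₂ (split-merge u v))))

segment-counts : ∀ {i j l} → IsStrict l → sol l ≡ i → length l ≡ i + 2 * j →
                 singles (segment 1 l) ≡ i × pairs (segment 1 l) ≡ j
segment-counts {i} {j} {l} l-strict sol≡i ℓ≡i+2j =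
  s≡i , *-cancelˡ-≡ _ _ 2 (+-cancelˡ-≡ i _ _ i+2q≡i+2j)
  where
  w = segment 1 l
  layout-w≡l : layout 1 w ≡ l
  layout-w≡l = layout-segment 0 l (strict⇒linked₀ l-strict)
  s≡i : singles w ≡ i
  s≡i = trans (sym (sol-layout 1 w)) (trans (cong sol layout-w≡l) sol≡i)
  i+2q≡i+2j : i + 2 * pairs w ≡ i + 2 * j
  i+2q≡i+2j = begin
    i + 2 * pairs w          ≡⟨ cong (λ s → s + 2 * pairs w) s≡i ⟨
    singles w + 2 * pairs w  ≡⟨ length-layout 1 w ⟨
    length (layout 1 w)      ≡⟨ cong length layout-w≡l ⟩
    length l                 ≡⟨ ℓ≡i+2j ⟩
    i + 2 * j                ∎

Words↔𝒟 : ∀ i j → Words i j ↔ 𝒟 i j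
Words↔𝒟 i j = restrict-↔ (×-irrelevant ≡-irrelevant ≡-irrelevant)
  (×-irrelevant isStrict-irrelevant (×-irrelevant ≡-irrelevant ≡-irrelevant))
  (layout 1) (segment 1)
  (λ {w} (s≡i , q≡j) → linked₀⇒strict (layout-linked 1 w (s≤s z≤n))
                     , trans (sol-layout 1 w) s≡i
                     , trans (length-layout 1 w) (cong₂ (λ s q → s + 2 * q) s≡i q≡j))
  (λ (l-strict , sol≡i , ℓ≡i+2j) → segment-counts l-strict sol≡i ℓ≡i+2j)
  (λ {l} (l-strict , _) → layout-segment 0 l (strict⇒linked₀ l-strict))
  (λ {w} _ → segment-layout 1 w)

φ : ∀ i j → (𝒫 i × ℰ j) ↔ 𝒟 i j
φ i j = Words↔𝒟 i j ↔-∘ (Gaps×Gaps↔Words i j ↔-∘ (𝒫↔Gaps i ×-↔ (𝒫↔Gaps j ↔-∘ ℰ↔𝒫 j)))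

sum-φ : ∀ i j (μ : 𝒫 i) (η : ℰ j) →
        sum (proj₁ (Inverse.to (φ i j) (μ , η))) ≡ sum (β i j) + sum (proj₁ μ) + sum (proj₁ η)
sum-φ i j μ η = begin
  sum (layout 1 (merge (proj₁ u) (proj₁ v)))
    ≡⟨ sum-layout-merge (proj₁ u) (proj₁ v) (proj₂ u) (proj₂ v) ⟩
  sum (β i j) + sumPrefixSums (proj₁ u) + 2 * sumPrefixSums (proj₁ v)
    ≡⟨ cong₂ (λ m n → sum (β i j) + m + 2 * n) (sumPrefixSums-𝒫↔Gaps μ) (sumPrefixSums-𝒫↔Gaps η′) ⟩
  sum (β i j) + sum (proj₁ μ) + 2 * sum (proj₁ η′)
    ≡⟨ cong (sum (β i j) + sum (proj₁ μ) +_) (2*sum-ℰ↔𝒫 η) ⟩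
  sum (β i j) + sum (proj₁ μ) + sum (proj₁ η) ∎
  where
  η′ = Inverse.to (ℰ↔𝒫 j) η
  u = Inverse.to (𝒫↔Gaps i) μ
  v = Inverse.to (𝒫↔Gaps j) η′

lemma2p1 : (i j : ℕ) →
    Σ ((𝒫 i × ℰ j) ⤖ 𝒟 i j) λ φ →
      (μ : 𝒫 i) (η : ℰ j) →
        let lam = proj₁ (Bijection.to φ (μ , η)) in
        (∣ lam ∣ₚ ≡ ∣ β i j ∣ₚ + ∣ proj₁ μ ∣ₚ + ∣ proj₁ η ∣ₚ)
        × (ℓ lam ≡ ℓ (β i j))
        × (sol lam ≡ sol (β i j))
lemma2p1 i j = ↔⇒⤖ (φ i j) , λ μ η →
  let (_ , _ , sol≡i , ℓ≡i+2j) = Inverse.to (φ i j) (μ , η) in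
  sum-φ i j μ η , trans ℓ≡i+2j (sym (length-β i j)) , trans sol≡i (sym (sol-β i j))
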